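{- Let $Q$ be a commutative involutive zero-divisor-free quantale, $X$ a set, and $\mathbf{A}$ an object of $\mathbf{Rel}_Q\text{ - }\mathbf{Alg}_{\mathrm{vN}}(X)$ with decomposition $\mathbf{A}=\prod_i e_i\mathbf{A}$ into indecomposable components, where the $e_i$ are the primitive subunital idempotents of $\mathbf{A}$. Then for each index $a$, the complement $\overline{e_a\mathbf{A}}=\prod_{i\neq a} e_i\mathbf{A}$ (the set of elements of $\mathbf{A}$ whose $e_a$-component is zero) is a prime ideal of $\mathbf{A}$.
   Context: A commutative involutive quantale $Q$ is a complete join-semilattice with a commutative monoid operation $\cdot$ (unit $1_Q$) distributing over arbitrary joins, and a join-preserving involution ${}^*$ with $(xy)^*=y^*x^*$, $1_Q^*=1_Q$; $0$ denotes its least element ($0\ne\top$). ZDF means $xy=0\Rightarrow x=0$ or $y=0$. In $\mathbf{Rel}_Q$, objects are sets, morphisms $X\to Y$ are functions $X\times Y\to Q$, with composition $(g\circ f)(x,z)=\bigvee_y f(x,y)\cdot g(y,z)$, identities the diagonal with $1_Q$ on the diagonal and $0$ elsewhere, and dagger $f^\dagger(y,x)=f(x,y)^*$. $\mathrm{Hom}(X,X)$ is a $Q$-semialgebra (addition = pointwise join, multiplication = composition, scalar multiplication pointwise, involution $\dagger$). Objects of $\mathbf{Rel}_Q\text{ - }\mathbf{Alg}_{\mathrm{vN}}(X)$ are subsets $\mathbf{A}\subseteq\mathrm{Hom}(X,X)$ containing $0,\mathrm{id}_X$, closed under binary joins, composition, scalar multiplication and $\dagger$, commutative, and equal to their double commutant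 $\mathbf{A}''$ (where $B'=\{f:fg=gf\ \forall g\in B\}$). A subunital idempotent of $\mathbf{A}$ is an idempotent $p$ with an idempotent $q$, $p\circ q=0$, $p+q=\mathrm{id}_X$; it is primitive if it is not a sum of two non-trivial subunital idempotents. For such $\mathbf{A}$ (with $Q$ ZDF) the primitive subunital idempotents $e_i$ satisfy $\mathbf{A}\cong\prod_i e_i\mathbf{A}$ via $f\mapsto(e_i\circ f)_i$, where $e_i\mathbf{A}=\{e_i\circ f:f\in\mathbf{A}\}$. An ideal of the commutative semiring $\mathbf{A}$ is a subset containing $0$, closed under addition and under multiplication by arbitrary elements of $\mathbf{A}$; it is prime if $st\in J$ implies $s\in J$ or $t\in J$. -}

module Defs where

open import Level using (0ℓ)
open import Data.Bool using (Bool; true; false)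
open import Data.Empty using (⊥)
open import Data.Sum using (_⊎_)
open import Data.Product using (Σ; _×_; _,_)
open import Relation.Nullary using (¬_)
open import Relation.Binary.PropositionalEquality using (_≡_)

record CommInvQuantale : Set₁ where
  infix  4 _≤_
  infixl 7 _·_
  field
    Carrier : Set
    _≤_     : Carrier → Carrier → Set
    ≤-refl    : ∀ {x} → x ≤ x
    ≤-trans   : ∀ {x y z} → x ≤ y → y ≤ z → x ≤ z
    ≤-antisym : ∀ {x y} → x ≤ y → y ≤ x → x ≡ y
    ⋁       : {I : Set} → (I → Carrier) → Carrier
    ⋁-ub    : ∀ {I : Set} (f : I → Carrier) (i : I) → f i ≤ ⋁ f
    ⋁-least : ∀ {I : Set} (f : I → Carrier) (b : Carrier) →
              (∀ i → f i ≤ b) → ⋁ f ≤ b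
    _·_     : Carrier → Carrier → Carrier
    1Q      : Carrier
    ·-assoc : ∀ x y z → (x · y) · z ≡ x · (y · z)
    ·-comm  : ∀ x y → x · y ≡ y · x
    ·-identityˡ : ∀ x → 1Q · x ≡ x
    ·-distribˡ-⋁ : ∀ {I : Set} (x : Carrier) (f : I → Carrier) →
                   x · ⋁ f ≡ ⋁ (λ i → x · f i)
    ·-distribʳ-⋁ : ∀ {I : Set} (f : I → Carrier) (x : Carrier) →
                   ⋁ f · x ≡ ⋁ (λ i → f i · x)
    _*      : Carrier → Carrier
    *-invol : ∀ x → (x *) * ≡ x
    *-⋁     : ∀ {I : Set} (f : I → Carrier) → (⋁ f) * ≡ ⋁ (λ i → (f i) *)
    *-·     : ∀ x y → (x · y) * ≡ (y *) · (x *)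
    *-1     : 1Q * ≡ 1Q

  0Q : Carrier
  0Q = ⋁ {⊥} (λ ())

  ⊤Q : Carrier
  ⊤Q = ⋁ {Carrier} (λ x → x)

  _∨_ : Carrier → Carrier → Carrier
  x ∨ y = ⋁ {Bool} (λ { true → x ; false → y })

NonDegenerate : CommInvQuantale → Set
NonDegenerate Q = ¬ (0Q ≡ ⊤Q)
  where open CommInvQuantale Q

ZDF : CommInvQuantale → Set
ZDF Q = ∀ x y → x · y ≡ 0Q → (x ≡ 0Q) ⊎ (y ≡ 0Q)
  where open CommInvQuantale Q

module RelQ (Q : CommInvQuantale) (X : Set) where
  open CommInvQuantale Q

  Hom : Set
  Hom = X → X → Carrier

  _≈_ : Hom → Hom → Set
  f ≈ g = ∀ x y → f x y ≡ g x y

  zeroH : Hom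
  zeroH _ _ = 0Q

  -- identity: 1 on the diagonal, 0 elsewhere (join over proofs of x ≡ y)
  idH : Hom
  idH x y = ⋁ {x ≡ y} (λ _ → 1Q)

  _∘_ : Hom → Hom → Hom
  (g ∘ f) x z = ⋁ {X} (λ y → f x y · g y z)

  _+_ : Hom → Hom → Hom
  (f + g) x y = f x y ∨ g x y

  _•_ : Carrier → Hom → Hom
  (c • f) x y = c · f x y

  _† : Hom → Hom
  (f †) y x = (f x y) *

  Subset : Set₁
  Subset = Hom → Set

  Commutant : Subset → Subset
  Commutant B f = ∀ g → B g → (f ∘ g) ≈ (g ∘ f)

  record IsVNAlg (A : Subset) : Set where
    field
      resp-≈  : ∀ {f g} → f ≈ g → A f → A g
      has-0   : A zeroH
      has-id  : A idH
      +-closed : ∀ {f g} → A f → A g → A (f + g)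
      ∘-closed : ∀ {f g} → A f → A g → A (g ∘ f)
      •-closed : ∀ c {f} → A f → A (c • f)
      †-closed : ∀ {f} → A f → A (f †)
      commutative : ∀ {f g} → A f → A g → (g ∘ f) ≈ (f ∘ g)
      double-commutant : ∀ f → (A f → Commutant (Commutant A) f)
                             × (Commutant (Commutant A) f → A f)

  module _ (A : Subset) where

    Idempotent : Hom → Set
    Idempotent p = (p ∘ p) ≈ p

    SubunitalIdem : Hom → Set
    SubunitalIdem p = A p × Idempotent p ×
      Σ Hom (λ q → A q × Idempotent q × (q ∘ p) ≈ zeroH × (p + q) ≈ idH)

    Primitive : Hom → Set
    Primitive p = SubunitalIdem p × ¬ (p ≈ zeroH) ×
      (∀ r s → SubunitalIdem r → SubunitalIdem s → (s ∘ r) ≈ zeroH →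
         p ≈ (r + s) → (r ≈ zeroH) ⊎ (s ≈ zeroH))

    record IsIdeal (J : Subset) : Set where
      field
        ⊆A      : ∀ {f} → J f → A f
        has-0   : J zeroH
        +-closed : ∀ {f g} → J f → J g → J (f + g)
        mult-closed : ∀ {f} g → J f → A g → J (g ∘ f)

    record IsPrimeIdeal (J : Subset) : Set where
      field
        isIdeal : IsIdeal J
        prime   : ∀ s t → A s → A t → J (t ∘ s) → J s ⊎ J t

    ComplementComponent : Hom → Subset
    ComplementComponent e f = A f × (e ∘ f) ≈ zeroH

module Submission where

-- Let s, t ∈ A with e t s = 0 and put f = e s.  Over a ZDF quantale it is decidable whether
-- a row of f vanishes, and by ZDF every element of the commutant A′ (which is †-closed) is
-- block diagonal for the partition of X into null rows and support rows of f.  Hence the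
-- diagonal projection onto the support of f lies in A″ = A, and composing e with it and with
-- its complement splits e into two orthogonal subunital idempotents.  By primitivity one of
-- them is zero: either e vanishes on the support of f, and then e s = f = 0; or e lives on the
-- support of f, so e t, which f annihilates, is zero by ZDF.

open import Defs
open import Level using (0ℓ)
open import Data.Bool using (Bool; true; false; not)
open import Data.Bool.Properties using () renaming (_≟_ to _≟ᵇ_)
open import Data.Empty using (⊥-elim)
open import Data.Product using (_,_; proj₁; proj₂)
open import Data.Sum using (_⊎_; [_,_]′)
import Data.Sum as Sum
open import Relation.Nullary using (Dec; yes; no; does)
open import Relation.Nullary.Decidable using (dec-true; dec-false)
open import Relation.Binary.Bundles using (Setoid)
open import Relation.Binary.PropositionalEquality
  using (_≡_; _≢_; refl; sym; trans; cong; cong₂; module ≡-Reasoning)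
import Relation.Binary.Reasoning.Setoid as SetoidReasoning

module QuantaleProperties (Q : CommInvQuantale) where
  open CommInvQuantale Q

  ≤-reflexive : ∀ {a b} → a ≡ b → a ≤ b
  ≤-reflexive refl = ≤-refl

  0≤ : ∀ a → 0Q ≤ a
  0≤ a = ⋁-least _ a (λ ())

  ≤0⇒≡0 : ∀ {a} → a ≤ 0Q → a ≡ 0Q
  ≤0⇒≡0 a≤0 = ≤-antisym a≤0 (0≤ _)

  ⋁-mono : ∀ {I : Set} {f g : I → Carrier} → (∀ i → f i ≤ g i) → ⋁ f ≤ ⋁ g
  ⋁-mono {g = g} f≤g = ⋁-least _ (⋁ g) (λ i → ≤-trans (f≤g i) (⋁-ub g i))

  ⋁-cong : ∀ {I : Set} {f g : I → Carrier} → (∀ i → f i ≡ g i) → ⋁ f ≡ ⋁ g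
  ⋁-cong f≡g = ≤-antisym (⋁-mono (λ i → ≤-reflexive (f≡g i)))
                         (⋁-mono (λ i → ≤-reflexive (sym (f≡g i))))

  ⋁-zero : ∀ {I : Set} {f : I → Carrier} → (∀ i → f i ≡ 0Q) → ⋁ f ≡ 0Q
  ⋁-zero f≡0 = ≤0⇒≡0 (⋁-least _ 0Q (λ i → ≤-reflexive (f≡0 i)))

  ⋁-swap : ∀ {I J : Set} (F : I → J → Carrier) →
           ⋁ (λ i → ⋁ (F i)) ≡ ⋁ (λ j → ⋁ (λ i → F i j))
  ⋁-swap F = ≤-antisym (swap≤ F) (swap≤ (λ j i → F i j))
    where
    swap≤ : ∀ {I J : Set} (F : I → J → Carrier) →
            ⋁ (λ i → ⋁ (F i)) ≤ ⋁ (λ j → ⋁ (λ i → F i j))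
    swap≤ F = ⋁-least _ _ (λ i → ⋁-least _ _ (λ j →
                ≤-trans (⋁-ub (λ i → F i j) i) (⋁-ub _ j)))

  ⋁-singletonˡ : ∀ {S : Set} {s : S} (F : S → Carrier) →
                 ⋁ (λ t → ⋁ {s ≡ t} (λ _ → F t)) ≡ F s
  ⋁-singletonˡ {s = s} F = ≤-antisym
    (⋁-least _ _ (λ t → ⋁-least _ _ (λ { refl → ≤-refl })))
    (≤-trans (⋁-ub (λ _ → F s) refl) (⋁-ub (λ t → ⋁ {s ≡ t} (λ _ → F t)) s))

  ⋁-singletonʳ : ∀ {S : Set} {s : S} (F : S → Carrier) →
                 ⋁ (λ t → ⋁ {t ≡ s} (λ _ → F t)) ≡ F s
  ⋁-singletonʳ {s = s} F = ≤-antisym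
    (⋁-least _ _ (λ t → ⋁-least _ _ (λ { refl → ≤-refl })))
    (≤-trans (⋁-ub (λ _ → F s) refl) (⋁-ub (λ t → ⋁ {t ≡ s} (λ _ → F t)) s))

  ·-identityʳ : ∀ x → x · 1Q ≡ x
  ·-identityʳ x = trans (·-comm x 1Q) (·-identityˡ x)

  ·-zeroʳ : ∀ x → x · 0Q ≡ 0Q
  ·-zeroʳ x = trans (·-distribˡ-⋁ x _) (⋁-zero (λ ()))

  ·-zeroˡ : ∀ x → 0Q · x ≡ 0Q
  ·-zeroˡ x = trans (·-comm 0Q x) (·-zeroʳ x)

  0*≡0 : 0Q * ≡ 0Q
  0*≡0 = trans (*-⋁ _) (⋁-zero (λ ()))

  x*≡0⇒x≡0 : ∀ {x} → x * ≡ 0Q → x ≡ 0Q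
  x*≡0⇒x≡0 {x} x*≡0 = trans (sym (*-invol x)) (trans (cong _* x*≡0) 0*≡0)

  ∨-ubˡ : ∀ a b → a ≤ a ∨ b
  ∨-ubˡ a b = ⋁-ub _ true

  ∨-ubʳ : ∀ a b → b ≤ a ∨ b
  ∨-ubʳ a b = ⋁-ub _ false

  ∨-least : ∀ {a b c} → a ≤ c → b ≤ c → a ∨ b ≤ c
  ∨-least {c = c} a≤c b≤c = ⋁-least _ c (λ { true → a≤c ; false → b≤c })

  ∨-comm : ∀ a b → a ∨ b ≡ b ∨ a
  ∨-comm a b = ≤-antisym (∨-least (∨-ubʳ b a) (∨-ubˡ b a)) (∨-least (∨-ubʳ a b) (∨-ubˡ a b))

  ∨-assoc : ∀ a b c → (a ∨ b) ∨ c ≡ a ∨ (b ∨ c)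
  ∨-assoc a b c = ≤-antisym
    (∨-least (∨-least (∨-ubˡ a _) (≤-trans (∨-ubˡ b c) (∨-ubʳ a _)))
             (≤-trans (∨-ubʳ b c) (∨-ubʳ a _)))
    (∨-least (≤-trans (∨-ubˡ a b) (∨-ubˡ _ c))
             (∨-least (≤-trans (∨-ubʳ a b) (∨-ubˡ _ c)) (∨-ubʳ _ c)))

  ∨-identityʳ : ∀ a → a ∨ 0Q ≡ a
  ∨-identityʳ a = ≤-antisym (∨-least ≤-refl (0≤ a)) (∨-ubˡ a 0Q)

  ∨-identityˡ : ∀ a → 0Q ∨ a ≡ a
  ∨-identityˡ a = trans (∨-comm 0Q a) (∨-identityʳ a)

  ⋁-∨ : ∀ {I : Set} (f g : I → Carrier) → ⋁ f ∨ ⋁ g ≡ ⋁ (λ i → f i ∨ g i)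
  ⋁-∨ f g = begin
    ⋁ f ∨ ⋁ g                 ≡⟨ ⋁-cong (λ { true → refl ; false → refl }) ⟩
    ⋁ (λ b → ⋁ (F b))         ≡⟨ ⋁-swap F ⟩
    ⋁ (λ i → ⋁ (λ b → F b i)) ≡⟨ ⋁-cong (λ i → ⋁-cong (λ { true → refl ; false → refl })) ⟩
    ⋁ (λ i → f i ∨ g i)       ∎
    where
    open ≡-Reasoning
    F : Bool → _
    F true  = f
    F false = g

  ·-distribˡ-∨ : ∀ c a b → c · (a ∨ b) ≡ (c · a) ∨ (c · b)
  ·-distribˡ-∨ c a b = trans (·-distribˡ-⋁ c _) (⋁-cong (λ { true → refl ; false → refl }))

  ·-distribʳ-∨ : ∀ c a b → (a ∨ b) · c ≡ (a · c) ∨ (b · c)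
  ·-distribʳ-∨ c a b = trans (·-distribʳ-⋁ _ c) (⋁-cong (λ { true → refl ; false → refl }))

  module ZeroDivisorFree (nd : NonDegenerate Q) (zdf : ZDF Q) where

    1≢0 : 1Q ≢ 0Q
    1≢0 1≡0 = nd (sym (⋁-zero {f = λ x → x} (λ x → begin
      x      ≡⟨ sym (·-identityʳ x) ⟩
      x · 1Q ≡⟨ cong (x ·_) 1≡0 ⟩
      x · 0Q ≡⟨ ·-zeroʳ x ⟩
      0Q     ∎)))
      where open ≡-Reasoning

    -- The truth value ⟦a≡0⟧ = ⋁_{a ≡ 0} 1 annihilates a, so by ZDF one of the two vanishes.
    zero? : ∀ a → Dec (a ≡ 0Q)
    zero? a = [ yes , (λ ⟦a≡0⟧≡0 → no (⟦a≡0⟧≡0⇒a≢0 ⟦a≡0⟧≡0)) ]′ (zdf a ⟦a≡0⟧ a·⟦a≡0⟧≡0)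
      where
      ⟦a≡0⟧ : Carrier
      ⟦a≡0⟧ = ⋁ {a ≡ 0Q} (λ _ → 1Q)

      a·⟦a≡0⟧≡0 : a · ⟦a≡0⟧ ≡ 0Q
      a·⟦a≡0⟧≡0 = trans (·-distribˡ-⋁ a _) (⋁-zero (λ a≡0 → trans (·-identityʳ a) a≡0))

      ⟦a≡0⟧≡0⇒a≢0 : ⟦a≡0⟧ ≡ 0Q → a ≢ 0Q
      ⟦a≡0⟧≡0⇒a≢0 ⟦a≡0⟧≡0 a≡0 = 1≢0 (≤0⇒≡0 (≤-trans (⋁-ub _ a≡0) (≤-reflexive ⟦a≡0⟧≡0)))

    x·y≡0⇒x≡0 : ∀ {x y} → y ≢ 0Q → x · y ≡ 0Q → x ≡ 0Q
    x·y≡0⇒x≡0 {x} {y} y≢0 xy≡0 = [ (λ x≡0 → x≡0) , (λ y≡0 → ⊥-elim (y≢0 y≡0)) ]′ (zdf x y xy≡0)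

module RelQProperties (Q : CommInvQuantale) (X : Set) where
  open CommInvQuantale Q
  open QuantaleProperties Q
  open RelQ Q X

  ≈-refl : ∀ {f} → f ≈ f
  ≈-refl x y = refl

  ≈-sym : ∀ {f g} → f ≈ g → g ≈ f
  ≈-sym f≈g x y = sym (f≈g x y)

  ≈-trans : ∀ {f g h} → f ≈ g → g ≈ h → f ≈ h
  ≈-trans f≈g g≈h x y = trans (f≈g x y) (g≈h x y)

  ≈-setoid : Setoid 0ℓ 0ℓ
  ≈-setoid = record
    { Carrier = Hom
    ; _≈_ = _≈_
    ; isEquivalence = record { refl = ≈-refl ; sym = ≈-sym ; trans = ≈-trans }
    }

  module ≈-Reasoning = SetoidReasoning ≈-setoid

  ∘-cong : ∀ {f f′ g g′} → g ≈ g′ → f ≈ f′ → (g ∘ f) ≈ (g′ ∘ f′)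
  ∘-cong g≈g′ f≈f′ x z = ⋁-cong (λ y → cong₂ _·_ (f≈f′ x y) (g≈g′ y z))

  +-cong : ∀ {f f′ g g′} → f ≈ f′ → g ≈ g′ → (f + g) ≈ (f′ + g′)
  +-cong f≈f′ g≈g′ x y = cong₂ _∨_ (f≈f′ x y) (g≈g′ x y)

  †-cong : ∀ {f g} → f ≈ g → (f †) ≈ (g †)
  †-cong f≈g y x = cong _* (f≈g x y)

  ∘-assoc : ∀ f g h → (h ∘ (g ∘ f)) ≈ ((h ∘ g) ∘ f)
  ∘-assoc f g h x z = begin
    ⋁ (λ y → ⋁ (λ w → f x w · g w y) · h y z)   ≡⟨ ⋁-cong (λ y → ·-distribʳ-⋁ _ (h y z)) ⟩
    ⋁ (λ y → ⋁ (λ w → (f x w · g w y) · h y z)) ≡⟨ ⋁-swap _ ⟩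
    ⋁ (λ w → ⋁ (λ y → (f x w · g w y) · h y z)) ≡⟨ ⋁-cong (λ w → ⋁-cong (λ y → ·-assoc _ _ _)) ⟩
    ⋁ (λ w → ⋁ (λ y → f x w · (g w y · h y z))) ≡⟨ ⋁-cong (λ w → sym (·-distribˡ-⋁ (f x w) _)) ⟩
    ⋁ (λ w → f x w · ⋁ (λ y → g w y · h y z))   ∎
    where open ≡-Reasoning

  ∘-distribˡ-+ : ∀ f g h → (h ∘ (f + g)) ≈ ((h ∘ f) + (h ∘ g))
  ∘-distribˡ-+ f g h x z =
    trans (⋁-cong (λ y → ·-distribʳ-∨ (h y z) (f x y) (g x y))) (sym (⋁-∨ _ _))

  ∘-distribʳ-+ : ∀ f g h → ((f + g) ∘ h) ≈ ((f ∘ h) + (g ∘ h))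
  ∘-distribʳ-+ f g h x z =
    trans (⋁-cong (λ y → ·-distribˡ-∨ (h x y) (f y z) (g y z))) (sym (⋁-∨ _ _))

  ∘-zeroˡ : ∀ f → (zeroH ∘ f) ≈ zeroH
  ∘-zeroˡ f x z = ⋁-zero (λ y → ·-zeroʳ (f x y))

  ∘-zeroʳ : ∀ f → (f ∘ zeroH) ≈ zeroH
  ∘-zeroʳ f x z = ⋁-zero (λ y → ·-zeroˡ (f y z))

  +-comm : ∀ f g → (f + g) ≈ (g + f)
  +-comm f g x y = ∨-comm _ _

  +-assoc : ∀ f g h → ((f + g) + h) ≈ (f + (g + h))
  +-assoc f g h x y = ∨-assoc _ _ _

  +-identityˡ : ∀ f → (zeroH + f) ≈ f
  +-identityˡ f x y = ∨-identityˡ _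

  +-identityʳ : ∀ f → (f + zeroH) ≈ f
  +-identityʳ f x y = ∨-identityʳ _

  ∘-interchange : ∀ a b c d → (c ∘ b) ≈ (b ∘ c) → ((a ∘ b) ∘ (c ∘ d)) ≈ ((a ∘ c) ∘ (b ∘ d))
  ∘-interchange a b c d cb≈bc = begin
    ((a ∘ b) ∘ (c ∘ d)) ≈⟨ ∘-assoc d c (a ∘ b) ⟩
    (((a ∘ b) ∘ c) ∘ d) ≈⟨ ∘-cong (≈-sym (∘-assoc c b a)) ≈-refl ⟩
    ((a ∘ (b ∘ c)) ∘ d) ≈⟨ ∘-cong (∘-cong ≈-refl (≈-sym cb≈bc)) ≈-refl ⟩
    ((a ∘ (c ∘ b)) ∘ d) ≈⟨ ∘-cong (∘-assoc b c a) ≈-refl ⟩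
    (((a ∘ c) ∘ b) ∘ d) ≈⟨ ≈-sym (∘-assoc d b (a ∘ c)) ⟩
    ((a ∘ c) ∘ (b ∘ d)) ∎
    where open ≈-Reasoning

  diag : (X → Carrier) → Hom
  diag d x y = ⋁ {x ≡ y} (λ _ → d x)

  ∘-diag : ∀ d h x z → (h ∘ diag d) x z ≡ d x · h x z
  ∘-diag d h x z = trans (⋁-cong (λ y → ·-distribʳ-⋁ _ (h y z))) (⋁-singletonˡ (λ y → d x · h y z))

  diag-∘ : ∀ d h x z → (diag d ∘ h) x z ≡ h x z · d z
  diag-∘ d h x z = trans (⋁-cong (λ y → ·-distribˡ-⋁ (h x y) _)) (⋁-singletonʳ (λ y → h x y · d y))

  diag-cong : ∀ {d d′} → (∀ x → d x ≡ d′ x) → diag d ≈ diag d′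
  diag-cong d≡d′ x y = ⋁-cong (λ _ → d≡d′ x)

  diag-∘-diag : ∀ d d′ → (diag d′ ∘ diag d) ≈ diag (λ x → d x · d′ x)
  diag-∘-diag d d′ x z = trans (∘-diag d (diag d′) x z) (·-distribˡ-⋁ (d x) _)

  diag-+-diag : ∀ d d′ → (diag d + diag d′) ≈ diag (λ x → d x ∨ d′ x)
  diag-+-diag d d′ x y = ⋁-∨ _ _

  ∘-identityʳ : ∀ f → (f ∘ idH) ≈ f
  ∘-identityʳ f x z = trans (∘-diag (λ _ → 1Q) f x z) (·-identityˡ (f x z))

  ∘-split : ∀ {p p′} e → (p + p′) ≈ idH → e ≈ ((e ∘ p) + (e ∘ p′))
  ∘-split {p} {p′} e p+p′≈id = begin
    e                        ≈⟨ ≈-sym (∘-identityʳ e) ⟩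
    (e ∘ idH)                ≈⟨ ∘-cong ≈-refl (≈-sym p+p′≈id) ⟩
    (e ∘ (p + p′))           ≈⟨ ∘-distribˡ-+ p p′ e ⟩
    ((e ∘ p) + (e ∘ p′))     ∎
    where open ≈-Reasoning

  indicator : Bool → Carrier
  indicator true  = 1Q
  indicator false = 0Q

  projection : (X → Bool) → Hom
  projection φ = diag (λ x → indicator (φ x))

  projection-idempotent : ∀ φ → (projection φ ∘ projection φ) ≈ projection φ
  projection-idempotent φ = ≈-trans (diag-∘-diag _ _) (diag-cong (λ x → idem (φ x)))
    where
    idem : ∀ b → indicator b · indicator b ≡ indicator b
    idem true  = ·-identityˡ 1Q
    idem false = ·-zeroˡ 0Q

  projection-orthogonal : ∀ φ → (projection (λ x → not (φ x)) ∘ projection φ) ≈ zeroH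
  projection-orthogonal φ x z =
    trans (diag-∘-diag (λ x → indicator (φ x)) _ x z) (⋁-zero (λ _ → disjoint (φ x)))
    where
    disjoint : ∀ b → indicator b · indicator (not b) ≡ 0Q
    disjoint true  = ·-identityˡ 0Q
    disjoint false = ·-zeroˡ 1Q

  projection-sum : ∀ φ → (projection φ + projection (λ x → not (φ x))) ≈ idH
  projection-sum φ = ≈-trans (diag-+-diag _ _) (diag-cong (λ x → cover (φ x)))
    where
    cover : ∀ b → indicator b ∨ indicator (not b) ≡ 1Q
    cover true  = ∨-identityʳ 1Q
    cover false = ∨-identityˡ 1Q

  †-involutive : ∀ f → ((f †) †) ≈ f
  †-involutive f x y = *-invol (f x y)

  †-∘ : ∀ f g → ((g ∘ f) †) ≈ ((f †) ∘ (g †))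
  †-∘ f g y x = trans (*-⋁ _) (⋁-cong (λ w → *-· (f x w) (g w y)))

  rowSup : Hom → X → Carrier
  rowSup f x = ⋁ (f x)

  rowSup-cong : ∀ {f g} → f ≈ g → ∀ x → rowSup f x ≡ rowSup g x
  rowSup-cong f≈g x = ⋁-cong (f≈g x)

  rowSup≡0⇒≡0 : ∀ f x → rowSup f x ≡ 0Q → ∀ y → f x y ≡ 0Q
  rowSup≡0⇒≡0 f x fx≡0 y = ≤0⇒≡0 (≤-trans (⋁-ub (f x) y) (≤-reflexive fx≡0))

  rowSup-∘-≡0 : ∀ f g x → rowSup f x ≡ 0Q → rowSup (g ∘ f) x ≡ 0Q
  rowSup-∘-≡0 f g x fx≡0 =
    ⋁-zero (λ z → ⋁-zero (λ w → trans (cong (_· g w z) (rowSup≡0⇒≡0 f x fx≡0 w)) (·-zeroˡ _)))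

  rowSup-∘-≡0⇒·≡0 : ∀ f g x → rowSup (f ∘ g) x ≡ 0Q → ∀ y → g x y · rowSup f y ≡ 0Q
  rowSup-∘-≡0⇒·≡0 f g x fgx≡0 y = ≤0⇒≡0 (≤-trans
    (≤-reflexive (·-distribˡ-⋁ (g x y) (f y)))
    (≤-trans (⋁-mono (λ z → ⋁-ub (λ w → g x w · f w z) y)) (≤-reflexive fgx≡0)))

module VNAlgebraProperties (Q : CommInvQuantale) (X : Set) {A : RelQ.Subset Q X}
                           (vn : RelQ.IsVNAlg Q X A) where
  open CommInvQuantale Q
  open QuantaleProperties Q
  open RelQ Q X
  open RelQProperties Q X
  open IsVNAlg vn using (has-0; +-closed; ∘-closed; †-closed; commutative; double-commutant)

  commutant-†-closed : ∀ {h} → Commutant A h → Commutant A (h †)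
  commutant-†-closed {h} h∈A′ g g∈A = begin
    ((h †) ∘ g)           ≈⟨ ∘-cong ≈-refl (≈-sym (†-involutive g)) ⟩
    ((h †) ∘ ((g †) †))   ≈⟨ ≈-sym (†-∘ h (g †)) ⟩
    (((g †) ∘ h) †)       ≈⟨ †-cong (≈-sym (h∈A′ (g †) (†-closed g∈A))) ⟩
    ((h ∘ (g †)) †)       ≈⟨ †-∘ (g †) h ⟩
    (((g †) †) ∘ (h †))   ≈⟨ ∘-cong (†-involutive g) ≈-refl ⟩
    (g ∘ (h †))           ∎
    where open ≈-Reasoning

  projection-∈ : ∀ φ → (∀ {h} → Commutant A h → ∀ x y → φ x ≢ φ y → h x y ≡ 0Q) →
                 A (projection φ)
  projection-∈ φ blockDiagonal = proj₂ (double-commutant _) (λ h h∈A′ x z → begin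
    (projection φ ∘ h) x z   ≡⟨ diag-∘ (λ x → indicator (φ x)) h x z ⟩
    h x z · indicator (φ z)  ≡⟨ commutes h∈A′ x z ⟩
    indicator (φ x) · h x z  ≡⟨ sym (∘-diag (λ x → indicator (φ x)) h x z) ⟩
    (h ∘ projection φ) x z   ∎)
    where
    open ≡-Reasoning
    commutes : ∀ {h} → Commutant A h → ∀ x z → h x z · indicator (φ z) ≡ indicator (φ x) · h x z
    commutes {h} h∈A′ x z with φ x ≟ᵇ φ z
    ... | yes φx≡φz = trans (·-comm _ _) (cong (λ b → indicator b · h x z) (sym φx≡φz))
    ... | no φx≢φz rewrite blockDiagonal h∈A′ x z φx≢φz = trans (·-zeroˡ _) (sym (·-zeroʳ _))

  idempotent-∘ : ∀ {a b} → A a → A b → Idempotent A a → Idempotent A b → Idempotent A (a ∘ b)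
  idempotent-∘ {a} {b} a∈A b∈A aa≈a bb≈b =
    ≈-trans (∘-interchange a b a b (commutative b∈A a∈A)) (∘-cong aa≈a bb≈b)

  idempotent-+ : ∀ {a b} → A a → A b → Idempotent A a → Idempotent A b → (a ∘ b) ≈ zeroH →
                 Idempotent A (a + b)
  idempotent-+ {a} {b} a∈A b∈A aa≈a bb≈b ab≈0 = begin
    ((a + b) ∘ (a + b))                        ≈⟨ ∘-distribˡ-+ a b (a + b) ⟩
    (((a + b) ∘ a) + ((a + b) ∘ b))            ≈⟨ +-cong (∘-distribʳ-+ a b a) (∘-distribʳ-+ a b b) ⟩
    (((a ∘ a) + (b ∘ a)) + ((a ∘ b) + (b ∘ b))) ≈⟨ +-cong (+-cong aa≈a ba≈0) (+-cong ab≈0 bb≈b) ⟩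
    ((a + zeroH) + (zeroH + b))                ≈⟨ +-cong (+-identityʳ a) (+-identityˡ b) ⟩
    (a + b)                                    ∎
    where
    open ≈-Reasoning
    ba≈0 : (b ∘ a) ≈ zeroH
    ba≈0 = ≈-trans (commutative a∈A b∈A) ab≈0

  complement-subunital : ∀ {p q} → A p → A q → Idempotent A p → Idempotent A q →
                         (q ∘ p) ≈ zeroH → (p + q) ≈ idH → SubunitalIdem A q
  complement-subunital {p} {q} p∈A q∈A pp≈p qq≈q qp≈0 p+q≈id =
    q∈A , qq≈q , p , p∈A , pp≈p , ≈-trans (commutative q∈A p∈A) qp≈0 , ≈-trans (+-comm q p) p+q≈id

  orthogonal-∘ : ∀ {e p p′} → A e → A p′ → (p′ ∘ p) ≈ zeroH → ((e ∘ p′) ∘ (e ∘ p)) ≈ zeroH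
  orthogonal-∘ {e} {p} {p′} e∈A p′∈A p′p≈0 =
    ≈-trans (∘-interchange e p′ e p (commutative p′∈A e∈A))
            (≈-trans (∘-cong ≈-refl p′p≈0) (∘-zeroʳ (e ∘ e)))

  subunital-∘ : ∀ {e p} → SubunitalIdem A e → SubunitalIdem A p → SubunitalIdem A (e ∘ p)
  subunital-∘ {e} {p} (e∈A , ee≈e , q , q∈A , qq≈q , qe≈0 , e+q≈id)
                      (p∈A , pp≈p , p′ , p′∈A , p′p′≈p′ , p′p≈0 , p+p′≈id) =
    ∘-closed p∈A e∈A , idempotent-∘ e∈A p∈A ee≈e pp≈p ,
    (q + (e ∘ p′)) , +-closed q∈A ep′∈A ,
    idempotent-+ q∈A ep′∈A qq≈q (idempotent-∘ e∈A p′∈A ee≈e p′p′≈p′) (q-annihilates p′) ,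
    complement-orthogonal , complement-sum
    where
    open ≈-Reasoning
    ep′∈A : A (e ∘ p′)
    ep′∈A = ∘-closed p′∈A e∈A
    q-annihilates : ∀ r → (q ∘ (e ∘ r)) ≈ zeroH
    q-annihilates r = ≈-trans (∘-assoc r e q) (≈-trans (∘-cong qe≈0 ≈-refl) (∘-zeroˡ r))
    complement-orthogonal : ((q + (e ∘ p′)) ∘ (e ∘ p)) ≈ zeroH
    complement-orthogonal = begin
      ((q + (e ∘ p′)) ∘ (e ∘ p))               ≈⟨ ∘-distribʳ-+ q (e ∘ p′) (e ∘ p) ⟩
      ((q ∘ (e ∘ p)) + ((e ∘ p′) ∘ (e ∘ p)))   ≈⟨ +-cong (q-annihilates p) (orthogonal-∘ e∈A p′∈A p′p≈0) ⟩
      (zeroH + zeroH)                          ≈⟨ +-identityʳ zeroH ⟩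
      zeroH                                    ∎
    complement-sum : ((e ∘ p) + (q + (e ∘ p′))) ≈ idH
    complement-sum = begin
      ((e ∘ p) + (q + (e ∘ p′)))   ≈⟨ ≈-sym (+-assoc (e ∘ p) q (e ∘ p′)) ⟩
      (((e ∘ p) + q) + (e ∘ p′))   ≈⟨ +-cong (+-comm (e ∘ p) q) ≈-refl ⟩
      ((q + (e ∘ p)) + (e ∘ p′))   ≈⟨ +-assoc q (e ∘ p) (e ∘ p′) ⟩
      (q + ((e ∘ p) + (e ∘ p′)))   ≈⟨ +-cong ≈-refl (≈-sym (∘-split e p+p′≈id)) ⟩
      (q + e)                      ≈⟨ +-comm q e ⟩
      (e + q)                      ≈⟨ e+q≈id ⟩
      idH                          ∎

  complement-isIdeal : ∀ {e} → A e → IsIdeal A (ComplementComponent A e)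
  complement-isIdeal {e} e∈A = record
    { ⊆A          = proj₁
    ; has-0       = has-0 , ∘-zeroʳ e
    ; +-closed    = λ (f∈A , ef≈0) (g∈A , eg≈0) → +-closed f∈A g∈A , sum-killed ef≈0 eg≈0
    ; mult-closed = λ g (f∈A , ef≈0) g∈A → ∘-closed f∈A g∈A , product-killed g∈A ef≈0
    }
    where
    open ≈-Reasoning
    sum-killed : ∀ {f g} → (e ∘ f) ≈ zeroH → (e ∘ g) ≈ zeroH → (e ∘ (f + g)) ≈ zeroH
    sum-killed {f} {g} ef≈0 eg≈0 = begin
      (e ∘ (f + g))          ≈⟨ ∘-distribˡ-+ f g e ⟩
      ((e ∘ f) + (e ∘ g))    ≈⟨ +-cong ef≈0 eg≈0 ⟩
      (zeroH + zeroH)        ≈⟨ +-identityʳ zeroH ⟩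
      zeroH                  ∎
    product-killed : ∀ {f g} → A g → (e ∘ f) ≈ zeroH → (e ∘ (g ∘ f)) ≈ zeroH
    product-killed {f} {g} g∈A ef≈0 = begin
      (e ∘ (g ∘ f))   ≈⟨ ∘-assoc f g e ⟩
      ((e ∘ g) ∘ f)   ≈⟨ ∘-cong (commutative g∈A e∈A) ≈-refl ⟩
      ((g ∘ e) ∘ f)   ≈⟨ ≈-sym (∘-assoc f e g) ⟩
      (g ∘ (e ∘ f))   ≈⟨ ∘-cong ≈-refl ef≈0 ⟩
      (g ∘ zeroH)     ≈⟨ ∘-zeroʳ g ⟩
      zeroH           ∎

module SupportProjection (Q : CommInvQuantale) (nd : NonDegenerate Q) (zdf : ZDF Q) (X : Set)
                         {A : RelQ.Subset Q X} (vn : RelQ.IsVNAlg Q X A)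
                         {f : RelQ.Hom Q X} (f∈A : A f) where
  open CommInvQuantale Q
  open QuantaleProperties Q
  open ZeroDivisorFree nd zdf
  open RelQ Q X
  open RelQProperties Q X
  open VNAlgebraProperties Q X vn

  rowIsZero : X → Bool
  rowIsZero x = does (zero? (rowSup f x))

  rowIsZero-true : ∀ x → rowSup f x ≡ 0Q → rowIsZero x ≡ true
  rowIsZero-true x = dec-true (zero? (rowSup f x))

  rowIsZero-false : ∀ x → rowSup f x ≢ 0Q → rowIsZero x ≡ false
  rowIsZero-false x = dec-false (zero? (rowSup f x))

  rowIsNonzero : X → Bool
  rowIsNonzero x = not (rowIsZero x)

  nullRows support : Hom
  nullRows = projection rowIsZero
  support  = projection rowIsNonzero

  commutant-entry≡0 : ∀ {h x y} → Commutant A h → rowSup f x ≡ 0Q → rowSup f y ≢ 0Q → h x y ≡ 0Q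
  commutant-entry≡0 {h} {x} {y} h∈A′ fx≡0 fy≢0 = x·y≡0⇒x≡0 fy≢0 (rowSup-∘-≡0⇒·≡0 f h x (begin
    rowSup (f ∘ h) x   ≡⟨ rowSup-cong (≈-sym (h∈A′ f f∈A)) x ⟩
    rowSup (h ∘ f) x   ≡⟨ rowSup-∘-≡0 f h x fx≡0 ⟩
    0Q                 ∎) y)
    where open ≡-Reasoning

  commutant-blockDiagonal : ∀ {h} → Commutant A h → ∀ x y → rowIsZero x ≢ rowIsZero y → h x y ≡ 0Q
  commutant-blockDiagonal h∈A′ x y different with zero? (rowSup f x) | zero? (rowSup f y)
  ... | yes _    | yes _    = ⊥-elim (different refl)
  ... | yes fx≡0 | no fy≢0  = commutant-entry≡0 h∈A′ fx≡0 fy≢0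
  ... | no fx≢0  | yes fy≡0 = x*≡0⇒x≡0 (commutant-entry≡0 (commutant-†-closed h∈A′) fy≡0 fx≢0)
  ... | no _     | no _     = ⊥-elim (different refl)

  nullRows-∈ : A nullRows
  nullRows-∈ = projection-∈ rowIsZero commutant-blockDiagonal

  support-∈ : A support
  support-∈ = projection-∈ _ (λ h∈A′ x y different →
    commutant-blockDiagonal h∈A′ x y (λ same → different (cong not same)))

  nullRows-subunital : SubunitalIdem A nullRows
  nullRows-subunital =
    nullRows-∈ , projection-idempotent rowIsZero ,
    support , support-∈ , projection-idempotent rowIsNonzero ,
    projection-orthogonal rowIsZero , projection-sum rowIsZero

  support-subunital : SubunitalIdem A support
  support-subunital =
    complement-subunital nullRows-∈ support-∈
      (projection-idempotent rowIsZero) (projection-idempotent rowIsNonzero)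
      (projection-orthogonal rowIsZero) (projection-sum rowIsZero)

  ∘-support : f ≈ (f ∘ support)
  ∘-support x z = sym (trans (∘-diag (λ x → indicator (rowIsNonzero x)) f x z) (fixes (zero? (rowSup f x))))
    where
    fixes : Dec (rowSup f x ≡ 0Q) → indicator (rowIsNonzero x) · f x z ≡ f x z
    fixes (yes fx≡0) = begin
      indicator (rowIsNonzero x) · f x z     ≡⟨ cong (λ b → indicator (not b) · f x z) (rowIsZero-true x fx≡0) ⟩
      0Q · f x z                            ≡⟨ ·-zeroˡ (f x z) ⟩
      0Q                                    ≡⟨ sym (rowSup≡0⇒≡0 f x fx≡0 z) ⟩
      f x z                                 ∎
      where open ≡-Reasoning
    fixes (no fx≢0) = trans (cong (λ b → indicator (not b) · f x z) (rowIsZero-false x fx≢0)) (·-identityˡ (f x z))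

  support-annihilator : ∀ {g} → (f ∘ g) ≈ zeroH → g ≈ (support ∘ g) → g ≈ zeroH
  support-annihilator {g} fg≈0 g≈support∘g x y with zero? (rowSup f y)
  ... | yes fy≡0 = begin
    g x y                                   ≡⟨ g≈support∘g x y ⟩
    (support ∘ g) x y                       ≡⟨ diag-∘ (λ x → indicator (rowIsNonzero x)) g x y ⟩
    g x y · indicator (rowIsNonzero y)      ≡⟨ cong (λ b → g x y · indicator (not b)) (rowIsZero-true y fy≡0) ⟩
    g x y · 0Q                              ≡⟨ ·-zeroʳ (g x y) ⟩
    0Q                                      ∎
    where open ≡-Reasoning
  ... | no fy≢0 = x·y≡0⇒x≡0 fy≢0 (rowSup-∘-≡0⇒·≡0 f g x (trans (rowSup-cong fg≈0 x) (⋁-zero (λ _ → refl))) y)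

module PrimeComplement (Q : CommInvQuantale) (nd : NonDegenerate Q) (zdf : ZDF Q) (X : Set)
                       {A : RelQ.Subset Q X} (vn : RelQ.IsVNAlg Q X A) where
  open RelQ Q X
  open RelQProperties Q X
  open VNAlgebraProperties Q X vn
  open IsVNAlg vn using (∘-closed; commutative)

  complement-prime : ∀ {e} → Primitive A e → ∀ s t → A s → A t → (e ∘ (t ∘ s)) ≈ zeroH →
                     ComplementComponent A e s ⊎ ComplementComponent A e t
  complement-prime {e} (e-subunital@(e∈A , ee≈e , _) , _ , indecomposable) s t s∈A t∈A e[ts]≈0 =
    Sum.map (λ e∘support≈0 → s∈A , es≈0 e∘support≈0) (λ e∘nullRows≈0 → t∈A , et≈0 e∘nullRows≈0)
      (Sum.swap (indecomposable (e ∘ nullRows) (e ∘ support)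
               (subunital-∘ e-subunital nullRows-subunital) (subunital-∘ e-subunital support-subunital)
               (orthogonal-∘ e∈A support-∈ (projection-orthogonal rowIsZero))
               (∘-split e (projection-sum rowIsZero))))
    where
    open SupportProjection Q nd zdf X vn (∘-closed s∈A e∈A)
    open ≈-Reasoning
    es≈0 : (e ∘ support) ≈ zeroH → (e ∘ s) ≈ zeroH
    es≈0 e∘support≈0 = begin
      (e ∘ s)               ≈⟨ ∘-support ⟩
      ((e ∘ s) ∘ support)   ≈⟨ ∘-cong (commutative s∈A e∈A) ≈-refl ⟩
      ((s ∘ e) ∘ support)   ≈⟨ ≈-sym (∘-assoc support e s) ⟩
      (s ∘ (e ∘ support))   ≈⟨ ∘-cong ≈-refl e∘support≈0 ⟩
      (s ∘ zeroH)           ≈⟨ ∘-zeroʳ s ⟩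
      zeroH                 ∎
    et≈0 : (e ∘ nullRows) ≈ zeroH → (e ∘ t) ≈ zeroH
    et≈0 e∘nullRows≈0 = support-annihilator es∘et≈0 et-in-support
      where
      es∘et≈0 : ((e ∘ s) ∘ (e ∘ t)) ≈ zeroH
      es∘et≈0 = begin
        ((e ∘ s) ∘ (e ∘ t))   ≈⟨ ∘-interchange e s e t (commutative s∈A e∈A) ⟩
        ((e ∘ e) ∘ (s ∘ t))   ≈⟨ ∘-cong ee≈e (commutative t∈A s∈A) ⟩
        (e ∘ (t ∘ s))         ≈⟨ e[ts]≈0 ⟩
        zeroH                 ∎
      et-in-support : (e ∘ t) ≈ (support ∘ (e ∘ t))
      et-in-support = begin
        (e ∘ t)                               ≈⟨ ∘-cong (∘-split e (projection-sum rowIsZero)) ≈-refl ⟩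
        (((e ∘ nullRows) + (e ∘ support)) ∘ t) ≈⟨ ∘-cong (+-cong e∘nullRows≈0 ≈-refl) ≈-refl ⟩
        ((zeroH + (e ∘ support)) ∘ t)         ≈⟨ ∘-cong (+-identityˡ (e ∘ support)) ≈-refl ⟩
        ((e ∘ support) ∘ t)                   ≈⟨ ∘-cong (commutative support-∈ e∈A) ≈-refl ⟩
        ((support ∘ e) ∘ t)                   ≈⟨ ≈-sym (∘-assoc t e support) ⟩
        (support ∘ (e ∘ t))                   ∎

  complement-isPrimeIdeal : ∀ {e} → Primitive A e → IsPrimeIdeal A (ComplementComponent A e)
  complement-isPrimeIdeal e-primitive@((e∈A , _) , _) = record
    { isIdeal = complement-isIdeal e∈A
    ; prime   = λ s t s∈A t∈A (_ , e[ts]≈0) → complement-prime e-primitive s t s∈A t∈A e[ts]≈0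
    }

theorem27 : (Q : CommInvQuantale) → NonDegenerate Q → ZDF Q → (X : Set) → (A : RelQ.Subset Q X) → RelQ.IsVNAlg Q X A → (e : RelQ.Hom Q X) → RelQ.Primitive Q X A e → RelQ.IsPrimeIdeal Q X A (RelQ.ComplementComponent Q X A e)
theorem27 Q nd zdf X A vn e = PrimeComplement.complement-isPrimeIdeal Q nd zdf X vn
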